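{- Let $G$ be a finite group, let $S$ be a simple self-dual $\mathbb{F}_2G$-module endowed with a non-degenerate $G$-invariant symmetric bilinear form $\varphi$, and let $k\ge 1$. The module $(U,\psi):=\perp_{i=1}^k(S,\varphi)$ (orthogonal direct sum of $k$ copies) contains an $\mathbb{F}_2G$-submodule $X$ with $X=X^{\perp,\psi}:=\{u\in U\mid \psi(u,x)=0 \text{ for all } x\in X\}$ if and only if $k$ is even.
   Context: For a right $\mathbb{F}_2G$-module $S$, $S^*=\mathrm{Hom}_{\mathbb{F}_2}(S,\mathbb{F}_2)$ with $(fg)(s)=f(sg^{ -1})$; $S$ is self-dual if $S\cong S^*$. A form is $G$-invariant if $\varphi(sg,s'g)=\varphi(s,s')$ for all $g\in G$. -}

module Defs where

open import Level using (0ℓ)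
open import Algebra.Bundles using (Group)
open import Data.Bool using (Bool; true; false; _xor_)
open import Data.Nat using (ℕ)
open import Data.Vec using (Vec; replicate; zipWith; map; foldr)
open import Data.List using (List)
open import Data.List.Relation.Unary.Any using (Any)
open import Data.Product using (Σ; ∃; _×_)
open import Data.Sum using (_⊎_)
open import Relation.Binary.PropositionalEquality using (_≡_)

-- The field F₂ is Bool with addition _xor_ (multiplication _∧_).
-- A finite-dimensional F₂-vector space of dimension n is F₂ⁿ = Vec Bool n.

V : ℕ → Set
V n = Vec Bool n

0V : ∀ {n} → V n
0V {n} = replicate n false

_⊕_ : ∀ {n} → V n → V n → V n
_⊕_ = zipWith _xor_

IsFiniteGroup : Group 0ℓ 0ℓ → Set
IsFiniteGroup G = Σ (List Carrier) λ xs → ∀ g → Any (g ≈_) xs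
  where open Group G

record RightModule (G : Group 0ℓ 0ℓ) (n : ℕ) : Set where
  open Group G
  field
    act      : Carrier → V n → V n
    act-cong : ∀ {g h} → g ≈ h → ∀ s → act g s ≡ act h s
    act-lin  : ∀ g s t → act g (s ⊕ t) ≡ act g s ⊕ act g t
    act-id   : ∀ s → act ε s ≡ s
    act-comp : ∀ g h s → act (g ∙ h) s ≡ act h (act g s)

module _ {G : Group 0ℓ 0ℓ} {n : ℕ} (M : RightModule G n) where
  open Group G
  open RightModule M

  IsSubmodule : (V n → Bool) → Set
  IsSubmodule Y = (Y 0V ≡ true)
                × (∀ s t → Y s ≡ true → Y t ≡ true → Y (s ⊕ t) ≡ true)
                × (∀ g s → Y s ≡ true → Y (act g s) ≡ true)

  IsSimple : Set
  IsSimple = (Σ (V n) λ s → s ≡ 0V → Data.Empty.⊥)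
           × (∀ Y → IsSubmodule Y →
                (∀ s → Y s ≡ true → s ≡ 0V) ⊎ (∀ s → Y s ≡ true))
    where import Data.Empty

  IsLinearFunctional : (V n → Bool) → Set
  IsLinearFunctional f = ∀ s t → f (s ⊕ t) ≡ f s xor f t

  -- S ≅ S* as right F₂G-modules, where (f g)(s) = f (s g⁻¹)
  IsSelfDual : Set
  IsSelfDual = Σ (V n → V n → Bool) λ θ →
      (∀ s → IsLinearFunctional (θ s))
    × (∀ s t u → θ (s ⊕ t) u ≡ θ s u xor θ t u)
    × (∀ s t → (∀ u → θ s u ≡ θ t u) → s ≡ t)
    × (∀ f → IsLinearFunctional f → Σ (V n) λ s → ∀ u → θ s u ≡ f u)
    × (∀ g s u → θ (act g s) u ≡ θ s (act (g ⁻¹) u))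

  IsNondegInvSymBilinear : (V n → V n → Bool) → Set
  IsNondegInvSymBilinear φ =
      (∀ s t u → φ (s ⊕ t) u ≡ φ s u xor φ t u)
    × (∀ s t u → φ s (t ⊕ u) ≡ φ s t xor φ s u)
    × (∀ s t → φ s t ≡ φ t s)
    × (∀ g s t → φ (act g s) (act g t) ≡ φ s t)
    × (∀ s → (∀ t → φ s t ≡ false) → s ≡ 0V)

OSum : ℕ → ℕ → Set
OSum n k = Vec (V n) k

0U : ∀ {n k} → OSum n k
0U {n} {k} = replicate k 0V

_⊞_ : ∀ {n k} → OSum n k → OSum n k → OSum n k
_⊞_ = zipWith _⊕_

actU : ∀ {G n k} → RightModule G n → Group.Carrier G → OSum n k → OSum n k
actU M g = map (RightModule.act M g)

ψ : ∀ {n k} → (V n → V n → Bool) → OSum n k → OSum n k → Bool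
ψ φ u v = foldr (λ _ → Bool) _xor_ false (zipWith φ u v)

IsSubmoduleU : ∀ {G n k} → RightModule G n → (OSum n k → Bool) → Set
IsSubmoduleU M X = (X 0U ≡ true)
                 × (∀ u v → X u ≡ true → X v ≡ true → X (u ⊞ v) ≡ true)
                 × (∀ g u → X u ≡ true → X (actU M g u) ≡ true)

IsSelfPerp : ∀ {n k} → (V n → V n → Bool) → (OSum n k → Bool) → Set
IsSelfPerp φ X = ∀ u → (X u ≡ true → ∀ x → X x ≡ true → ψ φ u x ≡ false)
                     × ((∀ x → X x ≡ true → ψ φ u x ≡ false) → X u ≡ true)

{-# OPTIONS --safe #-}
-- Write S^(k+1) = S × S^k and project a submodule X onto the first factor: image and
-- kernel are submodules, and the image is 0 or S since S is simple.  By induction on k this gives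
-- |X| = |S|^j for some j, and also |X| · |X⊥| = |S|^k; the only delicate case of the latter is
-- X ∩ (S × 0) = 0 with X projecting onto S, where self-duality (every linear functional on S is
-- φ(s, -)) yields a vector of X⊥ with nonzero head.  Hence X = X⊥ forces |S|^(2j) = |S|^k, i.e.
-- k = 2j.  Conversely, for k = 2m the diagonal {(a₁, a₁, …, aₘ, aₘ)} is a self-perpendicular submodule.
module Submission where

open import Defs
open import Level using (0ℓ)
open import Algebra.Bundles using (Group; CommutativeRing)
open import Algebra.Definitions using (Associative)
import Algebra.Properties.CommutativeSemigroup as CommutativeSemigroupProperties
open import Data.Bool using (Bool; true; false; _xor_; _∧_; not)
open import Data.Bool.Properties
  using (¬-not; not-involutive; xor-assoc; xor-same; xor-identityˡ; xor-identityʳ; xor-∧-commutativeRing)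
  renaming (_≟_ to _≟ᴮ_)
open import Data.Empty using (⊥-elim)
open import Data.Nat using (ℕ; zero; suc; _+_; _*_; _≤_; _<_; _≥_; _^_; z≤n; s≤s; >-nonZero)
open import Data.Nat.Divisibility using (_∣_; divides)
open import Data.Nat.Properties hiding (_≟_)
open import Data.Product using (Σ; ∃; _×_; _,_; proj₁; proj₂; uncurry)
open import Data.Sum using (_⊎_; inj₁; inj₂; [_,_]′)
open import Data.Vec using (Vec; []; _∷_; zipWith; replicate; map)
open import Data.Vec.Properties
  using (∷-injective; zipWith-assoc; zipWith-identityˡ; zipWith-identityʳ; map-replicate)
open import Function using (const)
open import Function.Bundles using (_⇔_; mk⇔)
open import Relation.Binary.Definitions using (DecidableEquality; tri<; tri≈; tri>)
open import Relation.Binary.PropositionalEquality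
open import Relation.Nullary.Decidable using (does; yes; no; map′; _×-dec_; dec-true)

_∈_ : {A : Set} → A → (A → Bool) → Set
a ∈ P = P a ≡ true

𝟙 : Bool → ℕ
𝟙 true  = 1
𝟙 false = 0

𝟙-injective : ∀ {a b} → 𝟙 a ≡ 𝟙 b → a ≡ b
𝟙-injective {true}  {true}  _ = refl
𝟙-injective {false} {false} _ = refl

𝟙-mono : ∀ {a b} → (a ≡ true → b ≡ true) → 𝟙 a ≤ 𝟙 b
𝟙-mono {true}  a⇒b rewrite a⇒b refl = ≤-refl
𝟙-mono {false} _ = z≤n

𝟙≤1 : ∀ a → 𝟙 a ≤ 1
𝟙≤1 true  = ≤-refl
𝟙≤1 false = z≤n

bool-ext : ∀ {a b} → (a ≡ true → b ≡ true) → (b ≡ true → a ≡ true) → a ≡ b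
bool-ext {true}          a⇒b _   = sym (a⇒b refl)
bool-ext {false} {true}  _   b⇒a = b⇒a refl
bool-ext {false} {false} _   _   = refl

false≢true : false ≢ true
false≢true ()

∧-true : ∀ {a b} → a ∧ b ≡ true → a ≡ true × b ≡ true
∧-true {true} {true} _ = refl , refl

not-true : ∀ {a} → not a ≡ true → a ≡ false
not-true {false} _ = refl

xor≡false⇒≡ : ∀ {a b} → a xor b ≡ false → a ≡ b
xor≡false⇒≡ {true}  {true}  _ = refl
xor≡false⇒≡ {false} {false} _ = refl

module ℕ+ = CommutativeSemigroupProperties +-commutativeSemigroup

+-≤-≡ : ∀ {a b c d} → a ≤ b → c ≤ d → a + c ≡ b + d → a ≡ b × c ≡ d
+-≤-≡ {a} {b} {c} {d} a≤b c≤d eq with <-cmp a b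
... | tri≈ _ a≡b _ = a≡b , +-cancelˡ-≡ a c d (trans eq (cong (_+ d) (sym a≡b)))
... | tri< a<b _ _ = ⊥-elim (<-irrefl eq (+-mono-<-≤ a<b c≤d))
... | tri> _ _ a>b = ⊥-elim (<⇒≱ a>b a≤b)

^-injectiveʳ : ∀ m → 1 < m → ∀ {a b} → m ^ a ≡ m ^ b → a ≡ b
^-injectiveʳ m 1<m {a} {b} eq with <-cmp a b
... | tri< a<b _ _ = ⊥-elim (<-irrefl eq (^-monoʳ-< m 1<m a<b))
... | tri≈ _ a≡b _ = a≡b
... | tri> _ _ a>b = ⊥-elim (<-irrefl (sym eq) (^-monoʳ-< m 1<m a>b))

Search : Set → Set
Search A = (p : A → Bool) → (∃ λ a → a ∈ p) ⊎ (∀ a → p a ≡ false)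

module _ {A : Set} (search : Search A) where

  any : (A → Bool) → Bool
  any p = [ const true , const false ]′ (search p)

  any-witness : ∀ p → any p ≡ true → ∃ λ a → a ∈ p
  any-witness p _ with search p
  ... | inj₁ found = found

  any-intro : ∀ p a → a ∈ p → any p ≡ true
  any-intro p a a∈p with search p
  ... | inj₁ _    = refl
  ... | inj₂ none = ⊥-elim (false≢true (trans (sym (none a)) a∈p))

  any-false : ∀ p → any p ≡ false → ∀ a → p a ≡ false
  any-false p _ with search p
  ... | inj₂ none = none

∷-search : ∀ {A k} → Search A → Search (Vec A k) → Search (Vec A (suc k))
∷-search searchA searchW p with searchA (λ a → any searchW (λ w → p (a ∷ w)))
... | inj₁ (a , found) = let (w , aw∈p) = any-witness searchW _ found in inj₁ (a ∷ w , aw∈p)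
... | inj₂ none        = inj₂ λ { (a ∷ w) → any-false searchW _ (none a) w }

∷-≟ : ∀ {A : Set} {k} → DecidableEquality A → DecidableEquality (Vec A k) →
      DecidableEquality (Vec A (suc k))
∷-≟ _≟ᴬ_ _≟ᵂ_ (a ∷ v) (b ∷ w) = map′ (uncurry (cong₂ _∷_)) ∷-injective (a ≟ᴬ b ×-dec v ≟ᵂ w)

record FiniteSum (A : Set) (_·_ : A → A → A) : Set₁ where
  field
    ∑           : (A → ℕ) → ℕ
    ∑-cong      : ∀ {F G} → (∀ a → F a ≡ G a) → ∑ F ≡ ∑ G
    ∑-+         : ∀ F G → ∑ (λ a → F a + G a) ≡ ∑ F + ∑ G
    ∑-*ʳ        : ∀ F c → ∑ (λ a → F a * c) ≡ ∑ F * c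
    ∑-mono      : ∀ F G → (∀ a → F a ≤ G a) → ∑ F ≤ ∑ G
    ≤-∑         : ∀ F a → F a ≤ ∑ F
    ∑-mono-≡    : ∀ F G → (∀ a → F a ≤ G a) → ∑ F ≡ ∑ G → ∀ a → F a ≡ G a
    ∑-swap      : ∀ {B : Set} (∑ᴮ : (B → ℕ) → ℕ) →
                  (∀ F G → ∑ᴮ (λ b → F b + G b) ≡ ∑ᴮ F + ∑ᴮ G) →
                  ∀ (F : A → B → ℕ) → ∑ (λ a → ∑ᴮ (F a)) ≡ ∑ᴮ (λ b → ∑ (λ a → F a b))
    ∑-translate : ∀ F c → ∑ (λ a → F (a · c)) ≡ ∑ F
    search      : Search A
    _≟_         : DecidableEquality A
    ∑-δ         : ∀ c → ∑ (λ a → 𝟙 (does (c ≟ a))) ≡ 1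

boolSum : FiniteSum Bool _xor_
boolSum = record
  { ∑           = λ F → F false + F true
  ; ∑-cong      = λ F≗G → cong₂ _+_ (F≗G false) (F≗G true)
  ; ∑-+         = λ F G → ℕ+.interchange (F false) (G false) (F true) (G true)
  ; ∑-*ʳ        = λ F c → sym (*-distribʳ-+ c (F false) (F true))
  ; ∑-mono      = λ F G F≤G → +-mono-≤ (F≤G false) (F≤G true)
  ; ≤-∑         = λ { F false → m≤m+n _ _ ; F true → m≤n+m _ _ }
  ; ∑-mono-≡    = λ F G F≤G eq → λ { false → proj₁ (+-≤-≡ (F≤G false) (F≤G true) eq)
                                    ; true  → proj₂ (+-≤-≡ (F≤G false) (F≤G true) eq) }
  ; ∑-swap      = λ ∑ᴮ ∑ᴮ-+ F → sym (∑ᴮ-+ (F false) (F true))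
  ; ∑-translate = λ { F false → refl ; F true → +-comm (F true) (F false) }
  ; search      = search
  ; _≟_         = _≟ᴮ_
  ; ∑-δ         = λ { false → refl ; true → refl }
  }
  where
  search : Search Bool
  search p with p false in p₀ | p true in p₁
  ... | true  | _     = inj₁ (false , p₀)
  ... | false | true  = inj₁ (true , p₁)
  ... | false | false = inj₂ λ { false → p₀ ; true → p₁ }

module FiniteSumProperties {A : Set} {_·_ : A → A → A} (F : FiniteSum A _·_) where
  open FiniteSum F public

  ∑-0 : ∑ (λ _ → 0) ≡ 0
  ∑-0 = trans (∑-*ʳ (λ _ → 0) 0) (*-zeroʳ (∑ λ _ → 0))

  _==_ : A → A → Bool
  a == b = does (a ≟ b)

  ==-sound : ∀ {a b} → a == b ≡ true → a ≡ b
  ==-sound {a} {b} _ with a ≟ b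
  ... | yes a≡b = a≡b

  ==-refl : ∀ a → a == a ≡ true
  ==-refl a = dec-true (a ≟ a) refl

  size : (A → Bool) → ℕ
  size P = ∑ λ a → 𝟙 (P a)

  size-cong : ∀ {P Q} → (∀ a → P a ≡ Q a) → size P ≡ size Q
  size-cong P≗Q = ∑-cong λ a → cong 𝟙 (P≗Q a)

  size-full : ∀ {P} → (∀ a → a ∈ P) → size P ≡ ∑ (λ _ → 1)
  size-full = size-cong

  size-empty : ∀ {P} → (∀ a → P a ≡ false) → size P ≡ 0
  size-empty none = trans (size-cong none) ∑-0

  size-singleton : ∀ {P} c → c ∈ P → (∀ a → a ∈ P → a ≡ c) → size P ≡ 1
  size-singleton {P} c c∈P unique = trans (size-cong P≗c==) (∑-δ c)
    where
    P≗c== : ∀ a → P a ≡ c == a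
    P≗c== a with c ≟ a
    ... | yes refl = c∈P
    ... | no c≢a   = ¬-not λ a∈P → c≢a (sym (unique a a∈P))

  size-subsingleton : ∀ {P} → (∀ a b → a ∈ P → b ∈ P → a ≡ b) → size P ≡ 𝟙 (any search P)
  size-subsingleton {P} unique with any search P in found
  ... | true  = let (c , c∈P) = any-witness search P found in
                size-singleton c c∈P λ a a∈P → unique a c a∈P c∈P
  ... | false = size-empty (any-false search P found)

  size-⊆-≡ : ∀ {P Q} → (∀ a → a ∈ P → a ∈ Q) → size P ≡ size Q → ∀ a → P a ≡ Q a
  size-⊆-≡ P⊆Q eq a = 𝟙-injective (∑-mono-≡ _ _ (λ a → 𝟙-mono (P⊆Q a)) eq a)

  -- Every fibre of an injective h has at most one point, and the fibre sizes add up to ∑ 1.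
  injective⇒surjective : (h : A → A) → (∀ {a b} → h a ≡ h b → a ≡ b) → ∀ t → ∃ λ s → h s ≡ t
  injective⇒surjective h h-inj t =
    let (s , hs==t) = any-witness search (fibre t)
                        (𝟙-injective (trans (sym (size-subsingleton (fibre-unique t))) (fibre-size t)))
    in s , ==-sound hs==t
    where
    fibre : A → A → Bool
    fibre t s = h s == t
    fibre-unique : ∀ t a b → a ∈ fibre t → b ∈ fibre t → a ≡ b
    fibre-unique t a b ha hb = h-inj (trans (==-sound ha) (sym (==-sound hb)))
    fibre-size≤1 : ∀ t → size (fibre t) ≤ 1
    fibre-size≤1 t = ≤-trans (≤-reflexive (size-subsingleton (fibre-unique t))) (𝟙≤1 _)
    fibre-sizes : ∑ (λ t → size (fibre t)) ≡ ∑ (λ _ → 1)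
    fibre-sizes = trans (sym (∑-swap ∑ ∑-+ λ s t → 𝟙 (fibre t s))) (∑-cong λ s → ∑-δ (h s))
    fibre-size : ∀ t → size (fibre t) ≡ 1
    fibre-size = ∑-mono-≡ _ _ fibre-size≤1 fibre-sizes

vecSum : ∀ {A _·_} → FiniteSum A _·_ → ∀ k → FiniteSum (Vec A k) (zipWith _·_)
vecSum {A} _ zero = record
  { ∑           = λ F → F []
  ; ∑-cong      = λ F≗G → F≗G []
  ; ∑-+         = λ _ _ → refl
  ; ∑-*ʳ        = λ _ _ → refl
  ; ∑-mono      = λ _ _ F≤G → F≤G []
  ; ≤-∑         = λ { _ [] → ≤-refl }
  ; ∑-mono-≡    = λ { _ _ _ eq [] → eq }
  ; ∑-swap      = λ _ _ _ → refl
  ; ∑-translate = λ { _ [] → refl }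
  ; search      = []-search
  ; _≟_         = λ { [] [] → yes refl }
  ; ∑-δ         = λ { [] → refl }
  }
  where
  []-search : Search (Vec A 0)
  []-search p with p [] in p[]
  ... | true  = inj₁ ([] , p[])
  ... | false = inj₂ λ { [] → p[] }
vecSum {A} {_·_} SA (suc k) = record
  { ∑           = λ F → A.∑ λ a → W.∑ λ w → F (a ∷ w)
  ; ∑-cong      = λ F≗G → A.∑-cong λ a → W.∑-cong λ w → F≗G (a ∷ w)
  ; ∑-+         = λ F G → trans (A.∑-cong λ a → W.∑-+ _ _) (A.∑-+ _ _)
  ; ∑-*ʳ        = λ F c → trans (A.∑-cong λ a → W.∑-*ʳ _ c) (A.∑-*ʳ _ c)
  ; ∑-mono      = λ F G F≤G → A.∑-mono _ _ λ a → W.∑-mono _ _ λ w → F≤G (a ∷ w)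
  ; ≤-∑         = λ { F (a ∷ w) → ≤-trans (W.≤-∑ _ w) (A.≤-∑ _ a) }
  ; ∑-mono-≡    = λ { F G F≤G eq (a ∷ w) →
                    W.∑-mono-≡ _ _ (λ w → F≤G (a ∷ w))
                      (A.∑-mono-≡ _ _ (λ a → W.∑-mono _ _ λ w → F≤G (a ∷ w)) eq a) w }
  ; ∑-swap      = λ ∑ᴮ ∑ᴮ-+ F → trans (A.∑-cong λ a → W.∑-swap ∑ᴮ ∑ᴮ-+ λ w → F (a ∷ w))
                                       (A.∑-swap ∑ᴮ ∑ᴮ-+ _)
  ; ∑-translate = λ { F (c ∷ d) → trans (A.∑-cong λ a → W.∑-translate (λ w → F ((a · c) ∷ w)) d)
                                        (A.∑-translate (λ a → W.∑ λ w → F (a ∷ w)) c) }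
  ; search      = ∷-search A.search W.search
  ; _≟_         = ∷-≟ A._≟_ W._≟_
  ; ∑-δ         = λ { (c ∷ d) → trans (A.∑-cong λ a → ∑-δ-tail (does (c A.≟ a)) d) (A.∑-δ c) }
  }
  where
  module A = FiniteSum SA
  module W = FiniteSumProperties (vecSum SA k)
  ∑-δ-tail : ∀ b d → W.∑ (λ w → 𝟙 (b ∧ does (d W.≟ w))) ≡ 𝟙 b
  ∑-δ-tail true  d = W.∑-δ d
  ∑-δ-tail false _ = W.∑-0

∑1-vecSum-boolSum : ∀ m → FiniteSum.∑ (vecSum boolSum m) (λ _ → 1) ≡ 2 ^ m
∑1-vecSum-boolSum zero    = refl
∑1-vecSum-boolSum (suc m) =
  cong₂ _+_ (∑1-vecSum-boolSum m) (trans (∑1-vecSum-boolSum m) (sym (+-identityʳ (2 ^ m))))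

zipWith-self : ∀ {A : Set} {f : A → A → A} {e : A} → (∀ x → f x x ≡ e) →
               ∀ {k} (xs : Vec A k) → zipWith f xs xs ≡ replicate k e
zipWith-self self []       = refl
zipWith-self self (x ∷ xs) = cong₂ _∷_ (self x) (zipWith-self self xs)

⊕-assoc : ∀ {n} → Associative _≡_ (_⊕_ {n})
⊕-assoc = zipWith-assoc xor-assoc

⊕-identityˡ : ∀ {n} (s : V n) → 0V ⊕ s ≡ s
⊕-identityˡ = zipWith-identityˡ xor-identityˡ

⊕-identityʳ : ∀ {n} (s : V n) → s ⊕ 0V ≡ s
⊕-identityʳ = zipWith-identityʳ xor-identityʳ

⊕-self : ∀ {n} (s : V n) → s ⊕ s ≡ 0V
⊕-self = zipWith-self xor-same

⊕≡0⇒≡ : ∀ {n} {s t : V n} → s ⊕ t ≡ 0V → s ≡ t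
⊕≡0⇒≡ {s = s} {t} s⊕t≡0 = begin
  s             ≡⟨ sym (⊕-identityʳ s) ⟩
  s ⊕ 0V        ≡⟨ cong (s ⊕_) (sym (⊕-self t)) ⟩
  s ⊕ (t ⊕ t)   ≡⟨ sym (⊕-assoc s t t) ⟩
  (s ⊕ t) ⊕ t   ≡⟨ cong (_⊕ t) s⊕t≡0 ⟩
  0V ⊕ t        ≡⟨ ⊕-identityˡ t ⟩
  t             ∎
  where open ≡-Reasoning

⊞-assoc : ∀ {n k} → Associative _≡_ (_⊞_ {n} {k})
⊞-assoc = zipWith-assoc ⊕-assoc

⊞-identityʳ : ∀ {n k} (u : OSum n k) → u ⊞ 0U ≡ u
⊞-identityʳ = zipWith-identityʳ ⊕-identityʳ

⊞-self : ∀ {n k} (u : OSum n k) → u ⊞ u ≡ 0U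
⊞-self = zipWith-self ⊕-self

module Xor = CommutativeSemigroupProperties (CommutativeRing.+-commutativeSemigroup xor-∧-commutativeRing)

module Setting {G : Group 0ℓ 0ℓ} {n : ℕ} (S : RightModule G n)
               (φ : V n → V n → Bool) (form : IsNondegInvSymBilinear S φ) where
  open Group G using (_⁻¹; inverseˡ)
  open RightModule S

  U : ℕ → Set
  U = OSum n

  φ-linearˡ : ∀ s t u → φ (s ⊕ t) u ≡ φ s u xor φ t u
  φ-linearˡ = proj₁ form

  φ-linearʳ : ∀ s t u → φ s (t ⊕ u) ≡ φ s t xor φ s u
  φ-linearʳ = proj₁ (proj₂ form)

  φ-sym : ∀ s t → φ s t ≡ φ t s
  φ-sym = proj₁ (proj₂ (proj₂ form))

  φ-invariant : ∀ g s t → φ (act g s) (act g t) ≡ φ s t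
  φ-invariant = proj₁ (proj₂ (proj₂ (proj₂ form)))

  φ-nondegenerate : ∀ s → (∀ t → φ s t ≡ false) → s ≡ 0V
  φ-nondegenerate = proj₂ (proj₂ (proj₂ (proj₂ form)))

  φ-zeroˡ : ∀ t → φ 0V t ≡ false
  φ-zeroˡ t = begin
    φ 0V t               ≡⟨ cong (λ z → φ z t) (sym (⊕-self 0V)) ⟩
    φ (0V ⊕ 0V) t        ≡⟨ φ-linearˡ 0V 0V t ⟩
    φ 0V t xor φ 0V t    ≡⟨ xor-same (φ 0V t) ⟩
    false                ∎
    where open ≡-Reasoning

  φ-zeroʳ : ∀ s → φ s 0V ≡ false
  φ-zeroʳ s = trans (φ-sym s 0V) (φ-zeroˡ s)

  ⟪_,_⟫ : ∀ {k} → U k → U k → Bool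
  ⟪ u , x ⟫ = ψ φ u x

  ⟪⟫-linearˡ : ∀ {k} (u v x : U k) → ⟪ u ⊞ v , x ⟫ ≡ ⟪ u , x ⟫ xor ⟪ v , x ⟫
  ⟪⟫-linearˡ []      []      []      = refl
  ⟪⟫-linearˡ (a ∷ u) (b ∷ v) (c ∷ x) =
    trans (cong₂ _xor_ (φ-linearˡ a b c) (⟪⟫-linearˡ u v x))
          (Xor.interchange (φ a c) (φ b c) ⟪ u , x ⟫ ⟪ v , x ⟫)

  ⟪⟫-sym : ∀ {k} (u x : U k) → ⟪ u , x ⟫ ≡ ⟪ x , u ⟫
  ⟪⟫-sym []      []      = refl
  ⟪⟫-sym (a ∷ u) (c ∷ x) = cong₂ _xor_ (φ-sym a c) (⟪⟫-sym u x)

  ⟪⟫-linearʳ : ∀ {k} (x u v : U k) → ⟪ x , u ⊞ v ⟫ ≡ ⟪ x , u ⟫ xor ⟪ x , v ⟫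
  ⟪⟫-linearʳ x u v = begin
    ⟪ x , u ⊞ v ⟫               ≡⟨ ⟪⟫-sym x (u ⊞ v) ⟩
    ⟪ u ⊞ v , x ⟫               ≡⟨ ⟪⟫-linearˡ u v x ⟩
    ⟪ u , x ⟫ xor ⟪ v , x ⟫     ≡⟨ cong₂ _xor_ (⟪⟫-sym u x) (⟪⟫-sym v x) ⟩
    ⟪ x , u ⟫ xor ⟪ x , v ⟫     ∎
    where open ≡-Reasoning

  ⟪⟫-zeroˡ : ∀ {k} (x : U k) → ⟪ 0U , x ⟫ ≡ false
  ⟪⟫-zeroˡ []      = refl
  ⟪⟫-zeroˡ (c ∷ x) = cong₂ _xor_ (φ-zeroˡ c) (⟪⟫-zeroˡ x)

  ⟪⟫-zeroʳ : ∀ {k} (u : U k) → ⟪ u , 0U ⟫ ≡ false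
  ⟪⟫-zeroʳ u = trans (⟪⟫-sym u 0U) (⟪⟫-zeroˡ u)

  ⟪⟫-invariant : ∀ {k} g (u x : U k) → ⟪ actU S g u , actU S g x ⟫ ≡ ⟪ u , x ⟫
  ⟪⟫-invariant g []      []      = refl
  ⟪⟫-invariant g (a ∷ u) (c ∷ x) = cong₂ _xor_ (φ-invariant g a c) (⟪⟫-invariant g u x)

  act-zero : ∀ g → act g 0V ≡ 0V
  act-zero g = begin
    act g 0V               ≡⟨ cong (act g) (sym (⊕-self 0V)) ⟩
    act g (0V ⊕ 0V)        ≡⟨ act-lin g 0V 0V ⟩
    act g 0V ⊕ act g 0V    ≡⟨ ⊕-self _ ⟩
    0V                     ∎
    where open ≡-Reasoning

  actU-zero : ∀ {k} g → actU S g (0U {n} {k}) ≡ 0U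
  actU-zero {k} g = trans (map-replicate (act g) 0V k) (cong (replicate k) (act-zero g))

  actU-inverse : ∀ {k} g (u : U k) → actU S g (actU S (g ⁻¹) u) ≡ u
  actU-inverse g []      = refl
  actU-inverse g (a ∷ u) = cong₂ _∷_ act-inverse (actU-inverse g u)
    where act-inverse = trans (sym (act-comp (g ⁻¹) g a)) (trans (act-cong (inverseˡ g) a) (act-id a))

  module Vsum = FiniteSumProperties (vecSum boolSum n)
  module Usum (k : ℕ) = FiniteSumProperties (vecSum (vecSum boolSum n) k)

  infix 8 #_ #ᵛ_

  #_ : ∀ {k} → (U k → Bool) → ℕ
  #_ {k} = Usum.size k

  #ᵛ_ : (V n → Bool) → ℕ
  #ᵛ_ = Vsum.size

  ∣S∣ : ℕ
  ∣S∣ = Vsum.∑ λ _ → 1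

  -- Opaque, so that X and u in  u ∈ perp X  remain inferable.
  opaque
    perp : ∀ {k} → (U k → Bool) → U k → Bool
    perp {k} X u = not (any (Usum.search k) λ x → X x ∧ ⟪ u , x ⟫)

    perp-intro : ∀ {k} {X : U k → Bool} {u} → (∀ x → x ∈ X → ⟪ u , x ⟫ ≡ false) → u ∈ perp X
    perp-intro {k} {X} {u} u⊥X with any (Usum.search k) (λ x → X x ∧ ⟪ u , x ⟫) in found
    ... | false = refl
    ... | true  = let (x , hit) = any-witness (Usum.search k) _ found
                      (x∈X , u·x) = ∧-true {X x} hit
                  in ⊥-elim (false≢true (trans (sym (u⊥X x x∈X)) u·x))

    perp-elim : ∀ {k} {X : U k → Bool} {u} → u ∈ perp X → ∀ x → x ∈ X → ⟪ u , x ⟫ ≡ false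
    perp-elim {k} {X} {u} u∈X⊥ x x∈X with any (Usum.search k) (λ x → X x ∧ ⟪ u , x ⟫) in found
    perp-elim {k} {X} {u} u∈X⊥ x x∈X | false =
      trans (cong (_∧ ⟪ u , x ⟫) (sym x∈X)) (any-false (Usum.search k) _ found x)
    perp-elim {k} {X} {u} () x x∈X | true

    perp-witness : ∀ {k} {X : U k → Bool} {u} → perp X u ≡ false → ∃ λ x → x ∈ X × ⟪ u , x ⟫ ≡ true
    perp-witness {k} {X} {u} u∉X⊥ with any (Usum.search k) (λ x → X x ∧ ⟪ u , x ⟫) in found
    perp-witness {k} {X} {u} u∉X⊥ | true = let (x , hit) = any-witness (Usum.search k) _ found
                                           in x , ∧-true {X x} hit
    perp-witness {k} {X} {u} () | false

  ⊆-perp-perp : ∀ {k} {X : U k → Bool} u → u ∈ X → u ∈ perp (perp X)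
  ⊆-perp-perp u u∈X = perp-intro λ v v∈X⊥ → trans (⟪⟫-sym u v) (perp-elim v∈X⊥ u u∈X)

  perp-submodule : ∀ {k} (X : U k → Bool) → IsSubmoduleU S X → IsSubmoduleU S (perp X)
  perp-submodule X (_ , _ , X-stable) =
      perp-intro (λ x _ → ⟪⟫-zeroˡ x)
    , (λ u v u∈X⊥ v∈X⊥ → perp-intro λ x x∈X →
         trans (⟪⟫-linearˡ u v x) (cong₂ _xor_ (perp-elim u∈X⊥ x x∈X) (perp-elim v∈X⊥ x x∈X)))
    , (λ g u u∈X⊥ → perp-intro λ x x∈X → begin
         ⟪ actU S g u , x ⟫                          ≡⟨ cong ⟪ actU S g u ,_⟫ (sym (actU-inverse g x)) ⟩
         ⟪ actU S g u , actU S g (actU S (g ⁻¹) x) ⟫ ≡⟨ ⟪⟫-invariant g u _ ⟩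
         ⟪ u , actU S (g ⁻¹) x ⟫                     ≡⟨ perp-elim u∈X⊥ _ (X-stable (g ⁻¹) x x∈X) ⟩
         false                                      ∎)
    where open ≡-Reasoning

  -- For X ⊆ S × S^k: its images under the two projections, and its intersections with S × 0 and 0 × S^k.
  module _ {k : ℕ} (X : U (suc k) → Bool) where

    heads : V n → Bool
    heads s = any (Usum.search k) λ w → X (s ∷ w)

    tails : U k → Bool
    tails w = any Vsum.search λ s → X (s ∷ w)

    heads₀ : V n → Bool
    heads₀ s = X (s ∷ 0U)

    tails₀ : U k → Bool
    tails₀ w = X (0V ∷ w)

  module _ {k : ℕ} (X : U (suc k) → Bool) (sub : IsSubmoduleU S X) where
    private
      0∈X : 0U ∈ X
      0∈X = proj₁ sub
      X-⊞ : ∀ u v → u ∈ X → v ∈ X → (u ⊞ v) ∈ X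
      X-⊞ = proj₁ (proj₂ sub)
      X-stable : ∀ g u → u ∈ X → actU S g u ∈ X
      X-stable = proj₂ (proj₂ sub)

    heads-submodule : IsSubmodule S (heads X)
    heads-submodule =
        any-intro (Usum.search k) _ 0U 0∈X
      , (λ s t s∈ t∈ →
           let (w , sw∈X) = any-witness (Usum.search k) _ s∈
               (v , tv∈X) = any-witness (Usum.search k) _ t∈
           in any-intro (Usum.search k) _ (w ⊞ v) (X-⊞ (s ∷ w) (t ∷ v) sw∈X tv∈X))
      , (λ g s s∈ →
           let (w , sw∈X) = any-witness (Usum.search k) _ s∈
           in any-intro (Usum.search k) _ (actU S g w) (X-stable g (s ∷ w) sw∈X))

    tails-submodule : IsSubmoduleU S (tails X)
    tails-submodule =
        any-intro Vsum.search _ 0V 0∈X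
      , (λ w v w∈ v∈ →
           let (s , sw∈X) = any-witness Vsum.search _ w∈
               (t , tv∈X) = any-witness Vsum.search _ v∈
           in any-intro Vsum.search _ (s ⊕ t) (X-⊞ (s ∷ w) (t ∷ v) sw∈X tv∈X))
      , (λ g w w∈ →
           let (s , sw∈X) = any-witness Vsum.search _ w∈
           in any-intro Vsum.search _ (act g s) (X-stable g (s ∷ w) sw∈X))

    heads₀-submodule : IsSubmodule S (heads₀ X)
    heads₀-submodule =
        0∈X
      , (λ s t s∈ t∈ → subst (λ z → ((s ⊕ t) ∷ z) ∈ X) (⊞-self 0U) (X-⊞ (s ∷ 0U) (t ∷ 0U) s∈ t∈))
      , (λ g s s∈ → subst (λ z → (act g s ∷ z) ∈ X) (actU-zero g) (X-stable g (s ∷ 0U) s∈))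

    tails₀-submodule : IsSubmoduleU S (tails₀ X)
    tails₀-submodule =
        0∈X
      , (λ w v w∈ v∈ → subst (λ z → (z ∷ (w ⊞ v)) ∈ X) (⊕-self 0V) (X-⊞ (0V ∷ w) (0V ∷ v) w∈ v∈))
      , (λ g w w∈ → subst (λ z → (z ∷ actU S g w) ∈ X) (act-zero g) (X-stable g (0V ∷ w) w∈))

    #≡#heads*#tails₀ : # X ≡ #ᵛ heads X * # tails₀ X
    #≡#heads*#tails₀ = trans (Vsum.∑-cong row) (Vsum.∑-*ʳ (λ s → 𝟙 (heads X s)) (# tails₀ X))
      where
      row-is-coset : ∀ {s} w₀ → (s ∷ w₀) ∈ X → ∀ w → X (s ∷ w) ≡ tails₀ X (w ⊞ w₀)
      row-is-coset {s} w₀ sw₀∈X w = bool-ext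
        (λ sw∈X → subst (λ z → (z ∷ (w ⊞ w₀)) ∈ X) (⊕-self s) (X-⊞ _ _ sw∈X sw₀∈X))
        (λ 0w′∈X → subst₂ (λ z y → (z ∷ y) ∈ X) (⊕-identityˡ s) (w⊞w₀⊞w₀≡w)
                     (X-⊞ (0V ∷ (w ⊞ w₀)) (s ∷ w₀) 0w′∈X sw₀∈X))
        where
        w⊞w₀⊞w₀≡w = trans (⊞-assoc w w₀ w₀) (trans (cong (w ⊞_) (⊞-self w₀)) (⊞-identityʳ w))
      row : ∀ s → Usum.size k (λ w → X (s ∷ w)) ≡ 𝟙 (heads X s) * # tails₀ X
      row s with heads X s in found
      ... | false = Usum.size-empty k (any-false (Usum.search k) _ found)
      ... | true  = let (w₀ , sw₀∈X) = any-witness (Usum.search k) _ found in begin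
        Usum.size k (λ w → X (s ∷ w))           ≡⟨ Usum.size-cong k (row-is-coset w₀ sw₀∈X) ⟩
        Usum.∑ k (λ w → 𝟙 (tails₀ X (w ⊞ w₀)))  ≡⟨ Usum.∑-translate k _ w₀ ⟩
        # tails₀ X                              ≡⟨ sym (+-identityʳ _) ⟩
        1 * # tails₀ X                          ∎
        where open ≡-Reasoning

    #≡#tails : (∀ s → s ∈ heads₀ X → s ≡ 0V) → # X ≡ # tails X
    #≡#tails heads₀≡0 = trans (Vsum.∑-swap (Usum.∑ k) (Usum.∑-+ k) λ s w → 𝟙 (X (s ∷ w)))
                              (Usum.∑-cong k λ w → Vsum.size-subsingleton (column-unique w))
      where
      column-unique : ∀ w s t → (s ∷ w) ∈ X → (t ∷ w) ∈ X → s ≡ t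
      column-unique w s t sw∈X tw∈X = ⊕≡0⇒≡ (heads₀≡0 (s ⊕ t)
        (subst (λ z → ((s ⊕ t) ∷ z) ∈ X) (⊞-self w) (X-⊞ _ _ sw∈X tw∈X)))

  tails₀-perp : ∀ {k} (X : U (suc k) → Bool) w → tails₀ (perp X) w ≡ perp (tails X) w
  tails₀-perp X w = bool-ext
    (λ 0w∈X⊥ → perp-intro λ z z∈tails →
       let (t , tz∈X) = any-witness Vsum.search _ z∈tails in
       subst (λ b → b xor ⟪ w , z ⟫ ≡ false) (φ-zeroˡ t) (perp-elim 0w∈X⊥ (t ∷ z) tz∈X))
    (λ w∈tails⊥ → perp-intro λ { (t ∷ z) tz∈X →
       subst (λ b → b xor ⟪ w , z ⟫ ≡ false) (sym (φ-zeroˡ t))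
         (perp-elim w∈tails⊥ z (any-intro Vsum.search _ t tz∈X)) })

  diagonal : ∀ m → U (m * 2) → Bool
  diagonal zero    []          = true
  diagonal (suc m) (a ∷ b ∷ w) = a Vsum.== b ∧ diagonal m w

  diagonal-∷⁺ : ∀ m {a w} → w ∈ diagonal m → (a ∷ a ∷ w) ∈ diagonal (suc m)
  diagonal-∷⁺ m {a} w∈D = cong₂ _∧_ (Vsum.==-refl a) w∈D

  diagonal-∷⁻ : ∀ m {a b w} → (a ∷ b ∷ w) ∈ diagonal (suc m) → a ≡ b × w ∈ diagonal m
  diagonal-∷⁻ m abw∈D = let (a==b , w∈D) = ∧-true abw∈D in Vsum.==-sound a==b , w∈D

  diagonal-0 : ∀ m → 0U ∈ diagonal m
  diagonal-0 zero    = refl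
  diagonal-0 (suc m) = diagonal-∷⁺ m (diagonal-0 m)

  diagonal-⊞ : ∀ m u v → u ∈ diagonal m → v ∈ diagonal m → (u ⊞ v) ∈ diagonal m
  diagonal-⊞ zero    []          []          _   _ = refl
  diagonal-⊞ (suc m) (a ∷ b ∷ u) (c ∷ d ∷ v) u∈D v∈D
    with diagonal-∷⁻ m {a} {b} {u} u∈D | diagonal-∷⁻ m {c} {d} {v} v∈D
  ... | refl , u∈D′ | refl , v∈D′ = diagonal-∷⁺ m (diagonal-⊞ m u v u∈D′ v∈D′)

  diagonal-act : ∀ m g u → u ∈ diagonal m → actU S g u ∈ diagonal m
  diagonal-act zero    g []          _   = refl
  diagonal-act (suc m) g (a ∷ b ∷ u) u∈D with diagonal-∷⁻ m {a} {b} {u} u∈D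
  ... | refl , u∈D′ = diagonal-∷⁺ m (diagonal-act m g u u∈D′)

  diagonal-submodule : ∀ m → IsSubmoduleU S (diagonal m)
  diagonal-submodule m = diagonal-0 m , diagonal-⊞ m , diagonal-act m

  diagonal-isotropic : ∀ m u x → u ∈ diagonal m → x ∈ diagonal m → ⟪ u , x ⟫ ≡ false
  diagonal-isotropic zero    []          []          _   _ = refl
  diagonal-isotropic (suc m) (a ∷ b ∷ u) (c ∷ d ∷ x) u∈D x∈D
    with diagonal-∷⁻ m {a} {b} {u} u∈D | diagonal-∷⁻ m {c} {d} {x} x∈D
  ... | refl , u∈D′ | refl , x∈D′ = begin
    φ a c xor (φ a c xor ⟪ u , x ⟫)   ≡⟨ sym (xor-assoc (φ a c) (φ a c) ⟪ u , x ⟫) ⟩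
    (φ a c xor φ a c) xor ⟪ u , x ⟫   ≡⟨ cong (_xor ⟪ u , x ⟫) (xor-same (φ a c)) ⟩
    ⟪ u , x ⟫                         ≡⟨ diagonal-isotropic m u x u∈D′ x∈D′ ⟩
    false                             ∎
    where open ≡-Reasoning

  -- Pairing with (t, t, 0) forces the first two coordinates to agree; pairing with (0, 0, x) recurses.
  diagonal-⊥⇒∈ : ∀ m u → (∀ x → x ∈ diagonal m → ⟪ u , x ⟫ ≡ false) → u ∈ diagonal m
  diagonal-⊥⇒∈ zero    []          _   = refl
  diagonal-⊥⇒∈ (suc m) (a ∷ b ∷ u) u⊥D =
    subst (λ z → (a ∷ z ∷ u) ∈ diagonal (suc m)) a≡b (diagonal-∷⁺ m (diagonal-⊥⇒∈ m u u⊥D′))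
    where
    a≡b : a ≡ b
    a≡b = ⊕≡0⇒≡ (φ-nondegenerate (a ⊕ b) λ t → begin
      φ (a ⊕ b) t                           ≡⟨ φ-linearˡ a b t ⟩
      φ a t xor φ b t                       ≡⟨ cong (φ a t xor_) (sym (xor-identityʳ (φ b t))) ⟩
      φ a t xor (φ b t xor false)           ≡⟨ cong (λ z → φ a t xor (φ b t xor z)) (sym (⟪⟫-zeroʳ u)) ⟩
      ⟪ a ∷ b ∷ u , t ∷ t ∷ 0U ⟫            ≡⟨ u⊥D (t ∷ t ∷ 0U) (diagonal-∷⁺ m {t} (diagonal-0 m)) ⟩
      false                                 ∎)
      where open ≡-Reasoning
    u⊥D′ : ∀ x → x ∈ diagonal m → ⟪ u , x ⟫ ≡ false
    u⊥D′ x x∈D = subst₂ (λ p q → p xor (q xor ⟪ u , x ⟫) ≡ false) (φ-zeroʳ a) (φ-zeroʳ b)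
                   (u⊥D (0V ∷ 0V ∷ x) (diagonal-∷⁺ m {0V} {x} x∈D))

  diagonal-selfPerp : ∀ m → IsSelfPerp φ (diagonal m)
  diagonal-selfPerp m u = (λ u∈D x → diagonal-isotropic m u x u∈D) , diagonal-⊥⇒∈ m u

  even⇒selfPerp : ∀ {k} → 2 ∣ k → Σ (U k → Bool) λ X → IsSubmoduleU S X × IsSelfPerp φ X
  even⇒selfPerp (divides m refl) = diagonal m , diagonal-submodule m , diagonal-selfPerp m

  module _ (simple : IsSimple S) (selfDual : IsSelfDual S) where

    dichotomy : ∀ Y → IsSubmodule S Y → (∀ s → s ∈ Y → s ≡ 0V) ⊎ (∀ s → s ∈ Y)
    dichotomy = proj₂ simple

    nonzero∈⇒full : ∀ {Y s} → IsSubmodule S Y → s ∈ Y → s ≢ 0V → ∀ t → t ∈ Y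
    nonzero∈⇒full {Y} {s} Y-sub s∈Y s≢0 with dichotomy Y Y-sub
    ... | inj₁ Y≡0 = ⊥-elim (s≢0 (Y≡0 s s∈Y))
    ... | inj₂ Y≡S = Y≡S

    #ᵛ-trivial : ∀ {Y} → IsSubmodule S Y → (∀ s → s ∈ Y → s ≡ 0V) → #ᵛ Y ≡ 1
    #ᵛ-trivial (0∈Y , _) Y≡0 = Vsum.size-singleton 0V 0∈Y Y≡0

    1<∣S∣ : 1 < ∣S∣
    1<∣S∣ = subst (1 <_) (sym (∑1-vecSum-boolSum n)) (^-monoʳ-< 2 (s≤s (s≤s z≤n)) (0<n (proj₁ simple)))
      where
      0<n : ∀ {m} → (∃ λ (s : V m) → s ≢ 0V) → 0 < m
      0<n {zero}  ([] , []≢0) = ⊥-elim ([]≢0 refl)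
      0<n {suc m} _ = s≤s z≤n

    -- θ identifies S with S*, so s ↦ θ⁻¹(φ s) is an injective self-map of the finite set S, hence onto.
    representable : ∀ f → IsLinearFunctional S f → ∃ λ s → ∀ t → φ s t ≡ f t
    representable f f-linear =
      let (t , θt≗f) = θ-onto f f-linear
          (s , ιs≡t) = Vsum.injective⇒surjective ι ι-injective t
      in s , λ u → trans (sym (ι-spec s u)) (trans (cong (λ z → θ z u) ιs≡t) (θt≗f u))
      where
      θ : V n → V n → Bool
      θ = proj₁ selfDual
      θ-onto : ∀ f → IsLinearFunctional S f → ∃ λ s → ∀ u → θ s u ≡ f u
      θ-onto = proj₁ (proj₂ (proj₂ (proj₂ (proj₂ selfDual))))
      ι : V n → V n
      ι s = proj₁ (θ-onto (φ s) (φ-linearʳ s))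
      ι-spec : ∀ s u → θ (ι s) u ≡ φ s u
      ι-spec s = proj₂ (θ-onto (φ s) (φ-linearʳ s))
      ι-injective : ∀ {a b} → ι a ≡ ι b → a ≡ b
      ι-injective {a} {b} ιa≡ιb = ⊕≡0⇒≡ (φ-nondegenerate (a ⊕ b) λ u →
        trans (φ-linearˡ a b u) (subst (λ z → φ a u xor z ≡ false) (φa≗φb u) (xor-same (φ a u))))
        where
        φa≗φb : ∀ u → φ a u ≡ φ b u
        φa≗φb u = trans (sym (ι-spec a u)) (trans (cong (λ z → θ z u) ιa≡ιb) (ι-spec b u))

    #-submodule : ∀ {k} (X : U k → Bool) → IsSubmoduleU S X → ∃ λ j → # X ≡ ∣S∣ ^ j
    #-submodule {zero} X (0∈X , _) = 0 , cong 𝟙 0∈X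
    #-submodule {suc k} X sub with #-submodule (tails₀ X) (tails₀-submodule X sub)
                                 | dichotomy (heads X) (heads-submodule X sub)
    ... | j , #tails₀ | inj₁ heads≡0 = j , trans (#≡#heads*#tails₀ X sub)
                                        (trans (cong₂ _*_ (#ᵛ-trivial (heads-submodule X sub) heads≡0) #tails₀)
                                               (*-identityˡ _))
    ... | j , #tails₀ | inj₂ heads≡S = suc j , trans (#≡#heads*#tails₀ X sub)
                                              (cong₂ _*_ (Vsum.size-full heads≡S) #tails₀)

    PerpCount : ℕ → Set
    PerpCount k = ∀ (X : U k → Bool) → IsSubmoduleU S X → # X * # perp X ≡ ∣S∣ ^ k

    perp-perp : ∀ {k} → PerpCount k → ∀ (X : U k → Bool) → IsSubmoduleU S X → ∀ u → perp (perp X) u ≡ X u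
    perp-perp {k} count X sub u = sym (Usum.size-⊆-≡ k ⊆-perp-perp (sym #X⊥⊥≡#X) u)
      where
      0<#X⊥ : 0 < # perp X
      0<#X⊥ = subst (λ b → 𝟙 b ≤ # perp X) (proj₁ (perp-submodule X sub))
                    (Usum.≤-∑ k (λ u → 𝟙 (perp X u)) 0U)
      #X⊥⊥≡#X : # perp (perp X) ≡ # X
      #X⊥⊥≡#X = *-cancelˡ-≡ _ _ (# perp X) {{>-nonZero 0<#X⊥}}
        (trans (count (perp X) (perp-submodule X sub)) (trans (sym (count X sub)) (*-comm (# X) _)))

    module _ {k : ℕ} (X : U (suc k) → Bool) (sub : IsSubmoduleU S X) where
      private
        X-⊞ : ∀ u v → u ∈ X → v ∈ X → (u ⊞ v) ∈ X
        X-⊞ = proj₁ (proj₂ sub)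

      headless⇒heads-perp-full : (∀ s → s ∈ heads X → s ≡ 0V) → ∀ s → s ∈ heads (perp X)
      headless⇒heads-perp-full heads≡0 s = any-intro (Usum.search k) _ 0U (perp-intro λ { (t ∷ x) tx∈X →
        subst (λ z → φ s z xor ⟪ 0U , x ⟫ ≡ false) (sym (heads≡0 t (any-intro (Usum.search k) _ x tx∈X)))
          (cong₂ _xor_ (φ-zeroʳ s) (⟪⟫-zeroˡ x)) })

      heads₀-full⇒heads-perp-zero : (∀ s → s ∈ heads₀ X) → ∀ s → s ∈ heads (perp X) → s ≡ 0V
      heads₀-full⇒heads-perp-zero heads₀≡S s s∈ =
        let (w , sw∈X⊥) = any-witness (Usum.search k) _ s∈ in
        φ-nondegenerate s λ t → trans (sym (xor-identityʳ (φ s t)))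
          (subst (λ b → φ s t xor b ≡ false) (⟪⟫-zeroʳ w) (perp-elim sw∈X⊥ (t ∷ 0U) (heads₀≡S t)))

      heads₀-full⇒tails₀≗tails : (∀ s → s ∈ heads₀ X) → ∀ w → tails₀ X w ≡ tails X w
      heads₀-full⇒tails₀≗tails heads₀≡S w = bool-ext (any-intro Vsum.search _ 0V) λ w∈tails →
        let (s , sw∈X) = any-witness Vsum.search _ w∈tails in
        subst₂ (λ a b → (a ∷ b) ∈ X) (⊕-self s) (⊞-identityʳ w)
          (X-⊞ (s ∷ w) (s ∷ 0U) sw∈X (heads₀≡S s))

      module Graph (count : PerpCount k) (heads≡S : ∀ s → s ∈ heads X)
                   (heads₀≡0 : ∀ s → s ∈ heads₀ X → s ≡ 0V) where

        section : V n → U k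
        section s = proj₁ (any-witness (Usum.search k) _ (heads≡S s))

        section-∈ : ∀ s → (s ∷ section s) ∈ X
        section-∈ s = proj₂ (any-witness (Usum.search k) _ (heads≡S s))

        -- Otherwise tails X ⊆ perp (perp (tails₀ X)) = tails₀ X, so X would contain (s, 0) with s ≠ 0.
        separating : ∃ λ w₁ → w₁ ∈ perp (tails₀ X) × perp (tails X) w₁ ≡ false
        separating with Usum.search k (λ w → perp (tails₀ X) w ∧ not (perp (tails X) w))
        ... | inj₁ (w₁ , hit) =
          let (w₁∈tails₀⊥ , w₁∉tails⊥) = ∧-true hit in w₁ , w₁∈tails₀⊥ , not-true w₁∉tails⊥
        ... | inj₂ none = ⊥-elim (s≢0 (heads₀≡0 s s0∈X))
          where
          s = proj₁ (proj₁ simple)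
          s≢0 = proj₂ (proj₁ simple)
          w = section s
          tails₀⊥⊆tails⊥ : ∀ v → v ∈ perp (tails₀ X) → v ∈ perp (tails X)
          tails₀⊥⊆tails⊥ v v∈tails₀⊥ = trans (sym (not-involutive _))
            (cong not (trans (cong (_∧ not (perp (tails X) v)) (sym v∈tails₀⊥)) (none v)))
          w∈tails₀ : w ∈ tails₀ X
          w∈tails₀ = trans (sym (perp-perp count (tails₀ X) (tails₀-submodule X sub) w))
            (perp-intro λ v v∈tails₀⊥ → trans (⟪⟫-sym w v)
              (perp-elim (tails₀⊥⊆tails⊥ v v∈tails₀⊥) w (any-intro Vsum.search _ s (section-∈ s))))
          s0∈X : (s ∷ 0U) ∈ X
          s0∈X = subst₂ (λ a b → (a ∷ b) ∈ X) (⊕-identityʳ s) (⊞-self w)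
                   (X-⊞ _ _ (section-∈ s) w∈tails₀)

        -- As w₁ ⊥ tails₀ X, ⟪ w₁ , w ⟫ depends only on the head s of (s, w) ∈ X; this linear functional
        -- of s is φ s₀ for some s₀, and then (s₀, w₁) ⊥ X.
        module _ (w₁ : U k) (w₁∈tails₀⊥ : w₁ ∈ perp (tails₀ X)) where

          g : V n → Bool
          g s = ⟪ w₁ , section s ⟫

          g-spec : ∀ s w → (s ∷ w) ∈ X → ⟪ w₁ , w ⟫ ≡ g s
          g-spec s w sw∈X = xor≡false⇒≡ (trans (sym (⟪⟫-linearʳ w₁ w (section s)))
            (perp-elim w₁∈tails₀⊥ (w ⊞ section s)
              (subst (λ z → (z ∷ (w ⊞ section s)) ∈ X) (⊕-self s) (X-⊞ _ _ sw∈X (section-∈ s)))))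

          g-linear : IsLinearFunctional S g
          g-linear s t = trans (sym (g-spec (s ⊕ t) _ (X-⊞ _ _ (section-∈ s) (section-∈ t))))
                               (⟪⟫-linearʳ w₁ (section s) (section t))

          lift : ∃ λ s₀ → (s₀ ∷ w₁) ∈ perp X × (∀ t → φ s₀ t ≡ g t)
          lift = let (s₀ , φs₀≗g) = representable g g-linear in
            s₀ , perp-intro (λ { (t ∷ x) tx∈X →
                   trans (cong₂ _xor_ (φs₀≗g t) (g-spec t x tx∈X)) (xor-same (g t)) }) , φs₀≗g

        heads-perp-full : ∀ s → s ∈ heads (perp X)
        heads-perp-full =
          let (w₁ , w₁∈tails₀⊥ , w₁∉tails⊥) = separating
              (s₀ , s₀w₁∈X⊥ , φs₀≗g) = lift w₁ w₁∈tails₀⊥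
              (z , z∈tails , w₁·z) = perp-witness w₁∉tails⊥
              (t , tz∈X) = any-witness Vsum.search _ z∈tails
              φs₀t : φ s₀ t ≡ true
              φs₀t = trans (φs₀≗g t) (trans (sym (g-spec w₁ w₁∈tails₀⊥ t z tz∈X)) w₁·z)
          in nonzero∈⇒full (heads-submodule (perp X) (perp-submodule X sub))
               (any-intro (Usum.search k) _ w₁ s₀w₁∈X⊥)
               (λ s₀≡0 → false≢true (trans (sym (φ-zeroˡ t)) (subst (λ a → φ a t ≡ true) s₀≡0 φs₀t)))

      heads₀-zero⇒heads-perp-full : PerpCount k → (∀ s → s ∈ heads₀ X → s ≡ 0V) →
                                    ∀ s → s ∈ heads (perp X)
      heads₀-zero⇒heads-perp-full count heads₀≡0 with dichotomy (heads X) (heads-submodule X sub)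
      ... | inj₁ heads≡0 = headless⇒heads-perp-full heads≡0
      ... | inj₂ heads≡S = Graph.heads-perp-full count heads≡S heads₀≡0

      #perp≡#heads*#perp-tails : # perp X ≡ #ᵛ heads (perp X) * # perp (tails X)
      #perp≡#heads*#perp-tails = trans (#≡#heads*#tails₀ (perp X) (perp-submodule X sub))
                                       (cong (#ᵛ heads (perp X) *_) (Usum.size-cong k (tails₀-perp X)))

    perp-count : ∀ k → PerpCount k
    perp-count zero    X (0∈X , _) = cong₂ (λ a b → 𝟙 a * 𝟙 b) 0∈X (perp-intro λ { [] _ → refl })
    perp-count (suc k) X sub = begin
      # X * # perp X                                   ≡⟨ cong (# X *_) (#perp≡#heads*#perp-tails X sub) ⟩
      # X * (#ᵛ heads (perp X) * # perp (tails X))     ≡⟨ sym (*-assoc (# X) _ _) ⟩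
      (# X * #ᵛ heads (perp X)) * # perp (tails X)     ≡⟨ cong (_* # perp (tails X)) balance ⟩
      (∣S∣ * # tails X) * # perp (tails X)             ≡⟨ *-assoc ∣S∣ _ _ ⟩
      ∣S∣ * (# tails X * # perp (tails X))             ≡⟨ cong (∣S∣ *_) (perp-count k _ (tails-submodule X sub)) ⟩
      ∣S∣ ^ suc k                                      ∎
      where
      open ≡-Reasoning
      -- Either X ∩ (S × 0) = 0, so that X ≅ tails X and X⊥ projects onto S,
      -- or X ⊇ S × 0, so that X = S × tails X and X⊥ ⊆ 0 × S^k.
      balance : # X * #ᵛ heads (perp X) ≡ ∣S∣ * # tails X
      balance with dichotomy (heads₀ X) (heads₀-submodule X sub)
      ... | inj₁ heads₀≡0 = begin
        # X * #ᵛ heads (perp X)   ≡⟨ cong₂ _*_ (#≡#tails X sub heads₀≡0)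
                                       (Vsum.size-full (heads₀-zero⇒heads-perp-full X sub (perp-count k) heads₀≡0)) ⟩
        # tails X * ∣S∣           ≡⟨ *-comm (# tails X) ∣S∣ ⟩
        ∣S∣ * # tails X           ∎
      ... | inj₂ heads₀≡S = begin
        # X * #ᵛ heads (perp X)         ≡⟨ cong₂ _*_ (#≡#heads*#tails₀ X sub)
                                             (#ᵛ-trivial (heads-submodule (perp X) (perp-submodule X sub))
                                                         (heads₀-full⇒heads-perp-zero X sub heads₀≡S)) ⟩
        #ᵛ heads X * # tails₀ X * 1     ≡⟨ *-identityʳ _ ⟩
        #ᵛ heads X * # tails₀ X         ≡⟨ cong₂ _*_ (Vsum.size-full heads≡S)
                                             (Usum.size-cong k (heads₀-full⇒tails₀≗tails X sub heads₀≡S)) ⟩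
        ∣S∣ * # tails X                 ∎
        where
        heads≡S : ∀ s → s ∈ heads X
        heads≡S s = any-intro (Usum.search k) _ 0U (heads₀≡S s)

    selfPerp⇒even : ∀ {k} → (Σ (U k → Bool) λ X → IsSubmoduleU S X × IsSelfPerp φ X) → 2 ∣ k
    selfPerp⇒even {k} (X , sub , X≡X⊥) = divides j k≡j*2
      where
      j = proj₁ (#-submodule X sub)
      #X≡∣S∣^j = proj₂ (#-submodule X sub)
      X≗X⊥ : ∀ u → X u ≡ perp X u
      X≗X⊥ u = bool-ext (λ u∈X → perp-intro (proj₁ (X≡X⊥ u) u∈X))
                        (λ u∈X⊥ → proj₂ (X≡X⊥ u) (perp-elim u∈X⊥))
      j+j≡k : j + j ≡ k
      j+j≡k = ^-injectiveʳ ∣S∣ 1<∣S∣ (begin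
        ∣S∣ ^ (j + j)          ≡⟨ ^-distribˡ-+-* ∣S∣ j j ⟩
        ∣S∣ ^ j * ∣S∣ ^ j      ≡⟨ cong₂ _*_ (sym #X≡∣S∣^j) (sym #X≡∣S∣^j) ⟩
        # X * # X              ≡⟨ cong (# X *_) (Usum.size-cong k X≗X⊥) ⟩
        # X * # perp X         ≡⟨ perp-count k X sub ⟩
        ∣S∣ ^ k                ∎)
        where open ≡-Reasoning
      k≡j*2 : k ≡ j * 2
      k≡j*2 = trans (sym j+j≡k) (trans (cong (j +_) (sym (+-identityʳ j))) (*-comm 2 j))

lemma2p7 : (G : Group 0ℓ 0ℓ) → IsFiniteGroup G →
    (n : ℕ) (S : RightModule G n) → IsSimple S → IsSelfDual S →
    (φ : V n → V n → Bool) → IsNondegInvSymBilinear S φ →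
    (k : ℕ) → k ≥ 1 →
    (Σ (OSum n k → Bool) λ X → IsSubmoduleU S X × IsSelfPerp φ X) ⇔ (2 ∣ k)
lemma2p7 G _ n S simple selfDual φ form k _ =
  mk⇔ (selfPerp⇒even simple selfDual) even⇒selfPerp
  where open Setting S φ form
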